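{- Let $n$ be a natural number congruent to $1, 5, 7, 8, 9, 11, 13, 14, 15,$ or $17$ modulo $18$. Then $n$ can be written as $n = z + p$ with $z$ a Zumkeller number and $p$ a prime if and only if $n \geq 8$.
   Context: A natural number $n$ is a Zumkeller number if the set of its positive divisors can be partitioned into two subsets with equal sums. -}

module Defs where

open import Data.Nat using (ℕ; zero; suc; _+_; _≥_)
open import Data.Nat.Divisibility using (_∣?_)
open import Data.List using (List; []; _∷_; filter; sum; upTo; map)
open import Data.Bool using (Bool; true; false)
open import Data.Product using (Σ; _×_; ∃-syntax)
open import Relation.Binary.PropositionalEquality using (_≡_)

divisors : ℕ → List ℕ
divisors n = filter (λ d → d ∣? n) (map suc (upTo n))

-- Sum of the elements of a list selected (true) resp. not selected (false)
-- by a labelling; a labelling of the divisors is a partition into two subsets.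
sumIn : List ℕ → List Bool → ℕ
sumIn [] _ = 0
sumIn (x ∷ xs) [] = 0
sumIn (x ∷ xs) (true ∷ bs) = x + sumIn xs bs
sumIn (x ∷ xs) (false ∷ bs) = sumIn xs bs

sumOut : List ℕ → List Bool → ℕ
sumOut [] _ = 0
sumOut (x ∷ xs) [] = x + sumOut xs []
sumOut (x ∷ xs) (true ∷ bs) = sumOut xs bs
sumOut (x ∷ xs) (false ∷ bs) = x + sumOut xs bs

Zumkeller : ℕ → Set
Zumkeller n = (n ≥ 1) × (∃[ bs ] sumIn (divisors n) bs ≡ sumOut (divisors n) bs)

-- Every n ≥ 8 in one of the listed classes mod 18 is 6t + p with p ∈ {2, 3, 5, 7, 11, 13}
-- prime and t ≡ 1 or 2 (mod 3). For 3 ∤ t, write t = 2^b r with r odd; then 6t = 2^(1+b)·3·r.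
-- The divisors of 2^(1+b)·3 split evenly, and an even split of the divisors of a lifts to a·r
-- for r coprime to a by labelling each divisor d like gcd(d, a), since both sums then scale
-- by σ(r). Conversely a Zumkeller number z has σ(z) ≥ 2z, because
-- z lies in one of the two parts; so z ≥ 6 and z + p ≥ 8.
module Submission where

open import Defs
open import Data.Bool using (Bool; true; false; if_then_else_; not; _∧_; _∨_)
open import Data.List using (List; []; _∷_; _++_; map; upTo; downFrom; cartesianProductWith)
open import Data.List.Membership.Propositional using (_∈_)
open import Data.List.Membership.Propositional.Properties using (∈-filter⁺; ∈-filter⁻; ∈-map⁺; ∈-map⁻; ∈-upTo⁺; ∈-downFrom⁺; ∈-downFrom⁻; ∈-cartesianProductWith⁺; ∈-cartesianProductWith⁻)
open import Data.List.Membership.Propositional.Properties.WithK using (unique∧set⇒bag)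
open import Data.List.Properties using (map-++; map-∘; map-cong-local)
open import Data.List.Relation.Binary.BagAndSetEquality using (∼bag⇒↭)
open import Data.List.Relation.Binary.Disjoint.Propositional using (Disjoint)
open import Data.List.Relation.Binary.Permutation.Propositional.Properties using (map⁺)
open import Data.List.Relation.Unary.All as All using (All; []; _∷_)
open import Data.List.Relation.Unary.Any using (here; there)
open import Data.List.Relation.Unary.Unique.Propositional using (Unique; []; _∷_)
import Data.List.Relation.Unary.Unique.Propositional.Properties as Unique
open import Data.Nat using (ℕ; zero; suc; _+_; _*_; _∸_; _^_; _%_; _/_; _≤_; _<_; _≥_; z≤n; s≤s; _≟_; _≤?_; NonZero; NonTrivial; ≢-nonZero; ≢-nonZero⁻¹; >-nonZero; >-nonZero⁻¹; nonTrivial⇒n>1)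
open import Data.Nat.Coprimality using (Coprime; coprime-divisor; coprime-/gcd; coprime⇒gcd≡1; prime⇒coprime)
import Data.Nat.Coprimality as Coprime
open import Data.Nat.Divisibility
open import Data.Nat.DivMod using (m≡m%n+[m/n]*n; m*[n/m]≡n)
open import Data.Nat.GCD using (gcd; gcd[m,n]∣m; gcd[m,n]∣n; gcd[m,n]≢0; c*gcd[m,n]≡gcd[cm,cn])
open import Data.Nat.Induction using (<-rec)
open import Data.Nat.ListAction using (sum)
open import Data.Nat.ListAction.Properties using (sum-++; sum-↭)
open import Data.Nat.Primality using (Prime; prime?; prime[2]; prime⇒irreducible; prime⇒nonZero; prime⇒nonTrivial)
open import Data.Nat.Properties
open import Algebra.Properties.CommutativeSemigroup +-commutativeSemigroup using (x∙yz≈y∙xz)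
open import Data.Nat.Tactic.RingSolver using (solve-∀)
open import Data.Product using (_×_; _,_; proj₂; ∃-syntax)
open import Data.Sum using (_⊎_; inj₁; inj₂; [_,_]′)
import Data.Sum as Sum
open import Function using (_∘_; id; it)
open import Function.Bundles using (_⇔_; mk⇔; Equivalence)
open import Relation.Binary.Definitions using (tri<; tri≈; tri>)
open import Relation.Binary.PropositionalEquality using (_≡_; _≢_; refl; sym; trans; cong; cong₂; subst; subst₂; module ≡-Reasoning)
open import Relation.Nullary using (¬_; yes; no; does; contradiction)
open import Relation.Nullary.Decidable using (from-yes; from-no; dec-true; dec-false)

select : (ℕ → Bool) → ℕ → ℕ
select g d = if g d then d else 0

sumWhere : (ℕ → Bool) → List ℕ → ℕ
sumWhere g xs = sum (map (select g) xs)

sumIn-map : ∀ g xs → sumIn xs (map g xs) ≡ sumWhere g xs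
sumIn-map g [] = refl
sumIn-map g (x ∷ xs) with g x
... | true  = cong (x +_) (sumIn-map g xs)
... | false = sumIn-map g xs

sumOut-map : ∀ g xs → sumOut xs (map g xs) ≡ sumWhere (not ∘ g) xs
sumOut-map g [] = refl
sumOut-map g (x ∷ xs) with g x
... | true  = sumOut-map g xs
... | false = cong (x +_) (sumOut-map g xs)

sumOut-[] : ∀ xs → sumOut xs [] ≡ sum xs
sumOut-[] [] = refl
sumOut-[] (x ∷ xs) = cong (x +_) (sumOut-[] xs)

sumIn+sumOut≡sum : ∀ xs bs → sumIn xs bs + sumOut xs bs ≡ sum xs
sumIn+sumOut≡sum [] bs = refl
sumIn+sumOut≡sum (x ∷ xs) [] = cong (x +_) (sumOut-[] xs)
sumIn+sumOut≡sum (x ∷ xs) (true ∷ bs) =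
  trans (+-assoc x _ _) (cong (x +_) (sumIn+sumOut≡sum xs bs))
sumIn+sumOut≡sum (x ∷ xs) (false ∷ bs) =
  trans (x∙yz≈y∙xz (sumIn xs bs) x (sumOut xs bs)) (cong (x +_) (sumIn+sumOut≡sum xs bs))

∈⇒≤sumOut[] : ∀ {x xs} → x ∈ xs → x ≤ sumOut xs []
∈⇒≤sumOut[] (here refl) = m≤m+n _ _
∈⇒≤sumOut[] {xs = y ∷ _} (there x∈) = ≤-trans (∈⇒≤sumOut[] x∈) (m≤n+m _ y)

∈⇒≤sumIn⊎≤sumOut : ∀ {x xs} bs → x ∈ xs → x ≤ sumIn xs bs ⊎ x ≤ sumOut xs bs
∈⇒≤sumIn⊎≤sumOut [] x∈ = inj₂ (∈⇒≤sumOut[] x∈)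
∈⇒≤sumIn⊎≤sumOut (true  ∷ bs) (here refl) = inj₁ (m≤m+n _ _)
∈⇒≤sumIn⊎≤sumOut (false ∷ bs) (here refl) = inj₂ (m≤m+n _ _)
∈⇒≤sumIn⊎≤sumOut {xs = y ∷ _} (true  ∷ bs) (there x∈) =
  Sum.map₁ (λ x≤ → ≤-trans x≤ (m≤n+m _ y)) (∈⇒≤sumIn⊎≤sumOut bs x∈)
∈⇒≤sumIn⊎≤sumOut {xs = y ∷ _} (false ∷ bs) (there x∈) =
  Sum.map₂ (λ x≤ → ≤-trans x≤ (m≤n+m _ y)) (∈⇒≤sumIn⊎≤sumOut bs x∈)

sum-map-cong : ∀ {A : Set} {f g : A → ℕ} xs → (∀ {x} → x ∈ xs → f x ≡ g x) →
  sum (map f xs) ≡ sum (map g xs)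
sum-map-cong xs f≡g = cong sum (map-cong-local (All.tabulate f≡g))

sum-map-*ˡ : ∀ c xs → sum (map (c *_) xs) ≡ c * sum xs
sum-map-*ˡ c [] = sym (*-zeroʳ c)
sum-map-*ˡ c (x ∷ xs) = trans (cong (c * x +_) (sum-map-*ˡ c xs)) (sym (*-distribˡ-+ c x _))

sum-map-*ʳ : ∀ {A : Set} (f : A → ℕ) c xs → sum (map (λ x → f x * c) xs) ≡ sum (map f xs) * c
sum-map-*ʳ f c [] = refl
sum-map-*ʳ f c (x ∷ xs) = trans (cong (f x * c +_) (sum-map-*ʳ f c xs)) (sym (*-distribʳ-+ c (f x) _))

sum-cartesianProductWith : ∀ {A B C : Set} (f : C → ℕ) (g : A → B → C) xs ys →
  sum (map f (cartesianProductWith g xs ys)) ≡ sum (map (λ x → sum (map (λ y → f (g x y)) ys)) xs)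
sum-cartesianProductWith f g [] ys = refl
sum-cartesianProductWith f g (x ∷ xs) ys = begin
  sum (map f (map (g x) ys ++ cartesianProductWith g xs ys))
    ≡⟨ cong sum (map-++ f (map (g x) ys) _) ⟩
  sum (map f (map (g x) ys) ++ map f (cartesianProductWith g xs ys))
    ≡⟨ sum-++ (map f (map (g x) ys)) _ ⟩
  sum (map f (map (g x) ys)) + sum (map f (cartesianProductWith g xs ys))
    ≡⟨ cong₂ _+_ (cong sum (sym (map-∘ ys))) (sum-cartesianProductWith f g xs ys) ⟩
  sum (map (λ y → f (g x y)) ys) + sum (map (λ x → sum (map (λ y → f (g x y)) ys)) xs) ∎
  where open ≡-Reasoning

sum-map-unique : ∀ (f : ℕ → ℕ) {xs ys} → Unique xs → Unique ys →
  (∀ {z} → z ∈ xs ⇔ z ∈ ys) → sum (map f xs) ≡ sum (map f ys)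
sum-map-unique f ux uy same = sum-↭ (map⁺ f (∼bag⇒↭ (unique∧set⇒bag ux uy same)))

-- Divisors

∣⇒nonZero : ∀ {m n} .{{_ : NonZero n}} → m ∣ n → NonZero m
∣⇒nonZero {n = n} m∣n = ≢-nonZero (λ m≡0 → ≢-nonZero⁻¹ n (0∣⇒≡0 (subst (_∣ n) m≡0 m∣n)))

∈-divisors⁺ : ∀ {d n} .{{_ : NonZero n}} → d ∣ n → d ∈ divisors n
∈-divisors⁺ {d} {n} d∣n with ∣⇒nonZero d∣n
∈-divisors⁺ {suc d} {n} d∣n | _ = ∈-filter⁺ (_∣? n) (∈-map⁺ suc (∈-upTo⁺ (∣⇒≤ d∣n))) d∣n

∈-divisors⁻ : ∀ {d n} → d ∈ divisors n → d ∣ n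
∈-divisors⁻ {n = n} d∈ = proj₂ (∈-filter⁻ (_∣? n) {xs = map suc (upTo n)} d∈)

divisors-unique : ∀ n → Unique (divisors n)
divisors-unique n = Unique.filter⁺ (_∣? n) (Unique.map⁺ suc-injective (Unique.upTo⁺ n))

sum-map-divisors : ∀ {n} .{{_ : NonZero n}} (f : ℕ → ℕ) {xs} → Unique xs →
  (∀ {d} → d ∣ n ⇔ d ∈ xs) → sum (map f (divisors n)) ≡ sum (map f xs)
sum-map-divisors {n} f ux ∣⇔∈ = sum-map-unique f (divisors-unique n) ux
  (mk⇔ (Equivalence.to ∣⇔∈ ∘ ∈-divisors⁻) (∈-divisors⁺ ∘ Equivalence.from ∣⇔∈))

gcd[x*y,a]≡x : ∀ {a b x y} → Coprime a b → x ∣ a → y ∣ b → gcd (x * y) a ≡ x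
gcd[x*y,a]≡x {a} {b} {x} {y} cop x∣a y∣b = begin
  gcd (x * y) a       ≡⟨ cong (gcd (x * y)) (m∣n⇒n≡m*quotient x∣a) ⟩
  gcd (x * y) (x * q) ≡⟨ c*gcd[m,n]≡gcd[cm,cn] x y q ⟨
  x * gcd y q         ≡⟨ cong (x *_) (coprime⇒gcd≡1 y⊥q) ⟩
  x * 1               ≡⟨ *-identityʳ x ⟩
  x                   ∎
  where
  open ≡-Reasoning
  q = quotient x∣a
  y⊥q : Coprime y q
  y⊥q (c∣y , c∣q) = cop (∣-trans c∣q (quotient-∣ x∣a) , ∣-trans c∣y y∣b)

∣*-coprime⇒factors : ∀ {a b d} .{{_ : NonZero a}} → Coprime a b → d ∣ a * b →
  ∃[ x ] ∃[ y ] (x ∣ a × y ∣ b × d ≡ x * y)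
∣*-coprime⇒factors {a} {b} {d} cop d∣ab =
  x , d / x , gcd[m,n]∣n d a , y∣b , sym (m*[n/m]≡n x∣d)
  where
  x = gcd d a
  x∣d = gcd[m,n]∣m d a
  instance
    x≢0 : NonZero x
    x≢0 = ≢-nonZero (gcd[m,n]≢0 d a (inj₂ (≢-nonZero⁻¹ a)))
  ab≡ : a * b ≡ x * (a / x * b)
  ab≡ = trans (cong (_* b) (sym (m*[n/m]≡n (gcd[m,n]∣n d a)))) (*-assoc x (a / x) b)
  y∣b : d / x ∣ b
  y∣b = coprime-divisor (coprime-/gcd d a)
          (*-cancelˡ-∣ x (subst₂ _∣_ (sym (m*[n/m]≡n x∣d)) ab≡ d∣ab))

products-unique : ∀ {a b} .{{_ : NonZero a}} → Coprime a b → ∀ {xs ys} →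
  Unique xs → Unique ys → All (_∣ a) xs → All (_∣ b) ys →
  Unique (cartesianProductWith _*_ xs ys)
products-unique cop [] uy ax ay = []
products-unique {a} cop {x ∷ xs} {ys} (x∉xs ∷ ux) uy (x∣a ∷ ax) ay =
  Unique.++⁺ (Unique.map⁺ (*-cancelˡ-≡ _ _ x {{∣⇒nonZero x∣a}}) uy)
             (products-unique cop ux uy ax ay) disjoint
  where
  disjoint : Disjoint (map (x *_) ys) (cartesianProductWith _*_ xs ys)
  disjoint (v∈xys , v∈rest)
    with y , y∈ , refl ← ∈-map⁻ (x *_) v∈xys
       | x′ , y′ , x′∈ , y′∈ , xy≡x′y′ ← ∈-cartesianProductWith⁻ _*_ xs ys v∈rest
    = All.lookup x∉xs x′∈ (begin
      x                 ≡⟨ gcd[x*y,a]≡x cop x∣a (All.lookup ay y∈) ⟨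
      gcd (x * y) a     ≡⟨ cong (λ v → gcd v a) xy≡x′y′ ⟩
      gcd (x′ * y′) a   ≡⟨ gcd[x*y,a]≡x cop (All.lookup ax x′∈) (All.lookup ay y′∈) ⟩
      x′                ∎)
    where open ≡-Reasoning

sum-divisors-*-coprime : ∀ {a b} .{{_ : NonZero a}} .{{_ : NonZero b}} → Coprime a b →
  (f : ℕ → ℕ) → sum (map f (divisors (a * b))) ≡
                sum (map (λ x → sum (map (λ y → f (x * y)) (divisors b))) (divisors a))
sum-divisors-*-coprime {a} {b} cop f =
  trans (sum-map-divisors {{m*n≢0 a b}} f unique (mk⇔ to from))
        (sum-cartesianProductWith f _*_ (divisors a) (divisors b))
  where
  unique = products-unique cop (divisors-unique a) (divisors-unique b)
             (All.tabulate ∈-divisors⁻) (All.tabulate ∈-divisors⁻)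
  to : ∀ {d} → d ∣ a * b → d ∈ cartesianProductWith _*_ (divisors a) (divisors b)
  to d∣ab with x , y , x∣a , y∣b , refl ← ∣*-coprime⇒factors cop d∣ab =
    ∈-cartesianProductWith⁺ _*_ (∈-divisors⁺ x∣a) (∈-divisors⁺ y∣b)
  from : ∀ {d} → d ∈ cartesianProductWith _*_ (divisors a) (divisors b) → d ∣ a * b
  from d∈ with x , y , x∈ , y∈ , refl ← ∈-cartesianProductWith⁻ _*_ (divisors a) (divisors b) d∈ =
    *-pres-∣ (∈-divisors⁻ {n = a} x∈) (∈-divisors⁻ {n = b} y∈)

m^i∣m^j : ∀ m {i j} → i ≤ j → m ^ i ∣ m ^ j
m^i∣m^j m {i} {j} i≤j = divides (m ^ (j ∸ i)) (begin
  m ^ j               ≡⟨ cong (m ^_) (m+[n∸m]≡n i≤j) ⟨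
  m ^ (i + (j ∸ i))   ≡⟨ ^-distribˡ-+-* m i (j ∸ i) ⟩
  m ^ i * m ^ (j ∸ i) ≡⟨ *-comm (m ^ i) _ ⟩
  m ^ (j ∸ i) * m ^ i ∎)
  where open ≡-Reasoning

^-injectiveʳ : ∀ {m} → 1 < m → ∀ {i j} → m ^ i ≡ m ^ j → i ≡ j
^-injectiveʳ 1<m {i} {j} eq with <-cmp i j
... | tri< i<j _ _ = contradiction eq (<⇒≢ (^-monoʳ-< _ 1<m i<j))
... | tri≈ _ i≡j _ = i≡j
... | tri> _ _ j<i = contradiction (sym eq) (<⇒≢ (^-monoʳ-< _ 1<m j<i))

prime∤⇒coprime : ∀ {p n} → Prime p → ¬ p ∣ n → Coprime p n
prime∤⇒coprime pp p∤n (c∣p , c∣n) with prime⇒irreducible pp c∣p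
... | inj₁ c≡1 = c≡1
... | inj₂ refl = contradiction c∣n p∤n

coprime-*ˡ : ∀ {m n o} → Coprime m o → Coprime n o → Coprime (m * n) o
coprime-*ˡ {m} {n} {o} m⊥o n⊥o {c} (c∣mn , c∣o) = n⊥o (coprime-divisor c⊥m c∣mn , c∣o)
  where
  c⊥m : Coprime c m
  c⊥m (e∣c , e∣m) = m⊥o (e∣m , ∣-trans e∣c c∣o)

coprime-^ˡ : ∀ {m o} k → Coprime m o → Coprime (m ^ k) o
coprime-^ˡ zero    m⊥o (c∣1 , _) = ∣1⇒≡1 c∣1
coprime-^ˡ (suc k) m⊥o = coprime-*ˡ m⊥o (coprime-^ˡ k m⊥o)

∣p^[1+k]⇒p*∣p^k⊎∣p^k : ∀ {p} → Prime p → ∀ k {x} → x ∣ p ^ suc k →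
  (∃[ q ] (x ≡ p * q × q ∣ p ^ k)) ⊎ x ∣ p ^ k
∣p^[1+k]⇒p*∣p^k⊎∣p^k {p} pp k {x} x∣ with p ∣? x
... | yes p∣x = inj₁ (quotient p∣x , x≡ , *-cancelˡ-∣ p {{prime⇒nonZero pp}} (subst (_∣ p * p ^ k) x≡ x∣))
  where x≡ = m∣n⇒n≡m*quotient p∣x
... | no p∤x = inj₂ (coprime-divisor (Coprime.sym (prime∤⇒coprime pp p∤x)) x∣)

∣p^k⇒≡p^i : ∀ {p} → Prime p → ∀ k {x} → x ∣ p ^ k → ∃[ i ] (i ≤ k × x ≡ p ^ i)
∣p^k⇒≡p^i pp zero x∣1 = 0 , z≤n , ∣1⇒≡1 x∣1
∣p^k⇒≡p^i {p} pp (suc k) x∣ with ∣p^[1+k]⇒p*∣p^k⊎∣p^k pp k x∣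
... | inj₁ (q , refl , q∣) with i , i≤k , refl ← ∣p^k⇒≡p^i pp k q∣ = suc i , s≤s i≤k , refl
... | inj₂ x∣p^k with i , i≤k , x≡ ← ∣p^k⇒≡p^i pp k x∣p^k = i , m≤n⇒m≤1+n i≤k , x≡

sum-divisors-^ : ∀ {p} → Prime p → ∀ k (f : ℕ → ℕ) →
  sum (map f (divisors (p ^ k))) ≡ sum (map (λ i → f (p ^ i)) (downFrom (suc k)))
sum-divisors-^ {p} pp k f =
  trans (sum-map-divisors f (Unique.map⁺ (^-injectiveʳ 1<p) (Unique.downFrom⁺ (suc k))) (mk⇔ to from))
        (cong sum (sym (map-∘ (downFrom (suc k)))))
  where
  instance _ = prime⇒nonZero pp
  instance _ = m^n≢0 p k
  1<p = nonTrivial⇒n>1 p {{prime⇒nonTrivial pp}}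
  to : ∀ {d} → d ∣ p ^ k → d ∈ map (p ^_) (downFrom (suc k))
  to d∣ with i , i≤k , refl ← ∣p^k⇒≡p^i pp k d∣ = ∈-map⁺ (p ^_) (∈-downFrom⁺ (s≤s i≤k))
  from : ∀ {d} → d ∈ map (p ^_) (downFrom (suc k)) → d ∣ p ^ k
  from d∈ with i , i∈ , refl ← ∈-map⁻ (p ^_) d∈ = m^i∣m^j p (≤-pred (∈-downFrom⁻ i∈))

-- Even splits of the divisors

EvenSplit : (ℕ → Bool) → ℕ → Set
EvenSplit g n = sumWhere g (divisors n) ≡ sumWhere (not ∘ g) (divisors n)

evenSplit⇒zumkeller : ∀ {n} .{{_ : NonZero n}} g → EvenSplit g n → Zumkeller n
evenSplit⇒zumkeller {n} g split = >-nonZero⁻¹ n , map g (divisors n) , (begin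
  sumIn (divisors n) (map g (divisors n))  ≡⟨ sumIn-map g (divisors n) ⟩
  sumWhere g (divisors n)                  ≡⟨ split ⟩
  sumWhere (not ∘ g) (divisors n)          ≡⟨ sumOut-map g (divisors n) ⟨
  sumOut (divisors n) (map g (divisors n)) ∎)
  where open ≡-Reasoning

zumkeller⇒2*n≤sum-divisors : ∀ {n} → Zumkeller n → 2 * n ≤ sum (divisors n)
zumkeller⇒2*n≤sum-divisors {n} (n≥1 , bs , in≡out) = begin
  2 * n     ≡⟨ cong (n +_) (+-identityʳ n) ⟩
  n + n     ≤⟨ +-mono-≤ n≤in n≤in ⟩
  ∑in + ∑in ≡⟨ cong (∑in +_) in≡out ⟩
  ∑in + sumOut (divisors n) bs ≡⟨ sumIn+sumOut≡sum (divisors n) bs ⟩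
  sum (divisors n) ∎
  where
  open ≤-Reasoning
  instance _ = >-nonZero n≥1
  ∑in = sumIn (divisors n) bs
  n≤in : n ≤ ∑in
  n≤in = [ id , subst (n ≤_) (sym in≡out) ]′ (∈⇒≤sumIn⊎≤sumOut bs (∈-divisors⁺ ∣-refl))

zumkeller⇒6≤ : ∀ {n} → Zumkeller n → 6 ≤ n
zumkeller⇒6≤ {0} (() , _)
zumkeller⇒6≤ {1} z = contradiction (zumkeller⇒2*n≤sum-divisors z) (from-no (2 ≤? 1))
zumkeller⇒6≤ {2} z = contradiction (zumkeller⇒2*n≤sum-divisors z) (from-no (4 ≤? 3))
zumkeller⇒6≤ {3} z = contradiction (zumkeller⇒2*n≤sum-divisors z) (from-no (6 ≤? 4))
zumkeller⇒6≤ {4} z = contradiction (zumkeller⇒2*n≤sum-divisors z) (from-no (8 ≤? 7))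
zumkeller⇒6≤ {5} z = contradiction (zumkeller⇒2*n≤sum-divisors z) (from-no (10 ≤? 6))
zumkeller⇒6≤ {suc (suc (suc (suc (suc (suc n)))))} _ = s≤s (s≤s (s≤s (s≤s (s≤s (s≤s z≤n)))))

sumWhere-divisors-*-coprime : ∀ {a r} .{{_ : NonZero a}} .{{_ : NonZero r}} → Coprime a r →
  ∀ g → sumWhere (λ d → g (gcd d a)) (divisors (a * r)) ≡ sumWhere g (divisors a) * sum (divisors r)
sumWhere-divisors-*-coprime {a} {r} cop g = begin
  sumWhere (λ d → g (gcd d a)) (divisors (a * r))
    ≡⟨ sum-divisors-*-coprime cop _ ⟩
  sum (map (λ x → sum (map (λ y → select (λ d → g (gcd d a)) (x * y)) (divisors r))) (divisors a))
    ≡⟨ sum-map-cong (divisors a) (λ x∈ → sum-map-cong (divisors r) (λ y∈ →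
         select-gcd (∈-divisors⁻ x∈) (∈-divisors⁻ y∈))) ⟩
  sum (map (λ x → sum (map (select g x *_) (divisors r))) (divisors a))
    ≡⟨ sum-map-cong (divisors a) (λ {x} _ → sum-map-*ˡ (select g x) (divisors r)) ⟩
  sum (map (λ x → select g x * sum (divisors r)) (divisors a))
    ≡⟨ sum-map-*ʳ (select g) (sum (divisors r)) (divisors a) ⟩
  sumWhere g (divisors a) * sum (divisors r) ∎
  where
  open ≡-Reasoning
  select-gcd : ∀ {x y} → x ∣ a → y ∣ r → select (λ d → g (gcd d a)) (x * y) ≡ select g x * y
  select-gcd {x} {y} x∣a y∣r rewrite gcd[x*y,a]≡x cop x∣a y∣r with g x
  ... | true  = refl
  ... | false = refl

evenSplit-*-coprime : ∀ {a r} .{{_ : NonZero a}} .{{_ : NonZero r}} → Coprime a r →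
  ∀ g → EvenSplit g a → EvenSplit (λ d → g (gcd d a)) (a * r)
evenSplit-*-coprime {a} {r} cop g split = begin
  sumWhere (λ d → g (gcd d a)) (divisors (a * r))         ≡⟨ sumWhere-divisors-*-coprime cop g ⟩
  sumWhere g (divisors a) * sum (divisors r)             ≡⟨ cong (_* sum (divisors r)) split ⟩
  sumWhere (not ∘ g) (divisors a) * sum (divisors r)     ≡⟨ sumWhere-divisors-*-coprime cop (not ∘ g) ⟨
  sumWhere (λ d → not (g (gcd d a))) (divisors (a * r)) ∎
  where open ≡-Reasoning

-- The numbers 2 ^ (1 + b) * 3

prime[3] : Prime 3
prime[3] = from-yes (prime? 3)

2^k⊥3 : ∀ k → Coprime (2 ^ k) 3
2^k⊥3 k = coprime-^ˡ k (Coprime.sym (prime⇒coprime prime[3] (n<1+n 2)))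

3∤2^k : ∀ k → ¬ 3 ∣ 2 ^ k
3∤2^k k 3∣2^k = contradiction (2^k⊥3 k (3∣2^k , ∣-refl)) λ ()

≢*3 : ∀ {m} n → ¬ 3 ∣ m → m ≢ n * 3
≢*3 n 3∤m refl = 3∤m (n∣m*n n)

level : (ℕ → Bool) → ℕ → ℕ
level g i = select g (2 ^ i) + select g (2 ^ i * 3)

-- The divisors of 2^(1+b)·3 labelled true are 2, 4, …, 2^b and 2^(1+b)·3; the others are
-- 1, 3, 6, …, 2^b·3 and 2^(1+b). Both parts sum to 2^(3+b) − 2.
label : ℕ → ℕ → Bool
label b d = does (d ≟ 2 ^ suc b * 3) ∨ (does (d ∣? 2 ^ b) ∧ does (2 ∣? d))

label-2^0 : ∀ b → label b (2 ^ 0) ≡ false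
label-2^0 b
  rewrite dec-false (1 ≟ 2 ^ suc b * 3) (≢*3 (2 ^ suc b) (3∤2^k 0))
        | dec-true (1 ∣? 2 ^ b) (1∣ _) = refl

label-2^[1+i] : ∀ {b i} → i < b → label b (2 ^ suc i) ≡ true
label-2^[1+i] {b} {i} i<b
  rewrite dec-false (2 ^ suc i ≟ 2 ^ suc b * 3) (≢*3 (2 ^ suc b) (3∤2^k (suc i)))
        | dec-true (2 ^ suc i ∣? 2 ^ b) (m^i∣m^j 2 i<b)
        | dec-true (2 ∣? 2 ^ suc i) (m∣m*n (2 ^ i)) = refl

label-2^[1+b] : ∀ b → label b (2 ^ suc b) ≡ false
label-2^[1+b] b
  rewrite dec-false (2 ^ suc b ≟ 2 ^ suc b * 3) (≢*3 (2 ^ suc b) (3∤2^k (suc b)))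
        | dec-false (2 ^ suc b ∣? 2 ^ b) (>⇒∤ {{m^n≢0 2 b}} (^-monoʳ-< 2 (n<1+n 1) {b} ≤-refl)) = refl

label-2^i*3 : ∀ {b i} → i ≤ b → label b (2 ^ i * 3) ≡ false
label-2^i*3 {b} {i} i≤b
  rewrite dec-false (2 ^ i * 3 ≟ 2 ^ suc b * 3)
            (<⇒≢ (s≤s i≤b) ∘ ^-injectiveʳ (n<1+n 1) {i} {suc b} ∘ *-cancelʳ-≡ (2 ^ i) (2 ^ suc b) 3)
        | dec-false (2 ^ i * 3 ∣? 2 ^ b) (3∤2^k b ∘ m*n∣⇒n∣ (2 ^ i) 3) = refl

label-2^[1+b]*3 : ∀ b → label b (2 ^ suc b * 3) ≡ true
label-2^[1+b]*3 b rewrite dec-true (2 ^ suc b * 3 ≟ 2 ^ suc b * 3) refl = refl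

-- The level sums are 2^(1+j) − 2 and 3·2^(1+j) − 2; adding 2 avoids truncated subtraction.
levels-label : ∀ b j → j ≤ b → sum (map (level (label b)) (downFrom (suc j))) + 2 ≡ 2 ^ suc j
levels-label b zero _ rewrite label-2^0 b | label-2^i*3 {b} {0} z≤n = refl
levels-label b (suc j) j<b rewrite label-2^[1+i] j<b | label-2^i*3 j<b = begin
  2 ^ suc j + 0 + S + 2   ≡⟨ +-assoc (2 ^ suc j + 0) S 2 ⟩
  2 ^ suc j + 0 + (S + 2) ≡⟨ cong (2 ^ suc j + 0 +_) (levels-label b j (<⇒≤ j<b)) ⟩
  2 ^ suc j + 0 + 2 ^ suc j ≡⟨ double (2 ^ suc j) ⟩
  2 * 2 ^ suc j ∎
  where
  open ≡-Reasoning
  S = sum (map (level (label b)) (downFrom (suc j)))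
  double : ∀ p → p + 0 + p ≡ 2 * p
  double = solve-∀

levels-not-label : ∀ b j → j ≤ b → sum (map (level (not ∘ label b)) (downFrom (suc j))) + 2 ≡ 3 * 2 ^ suc j
levels-not-label b zero _ rewrite label-2^0 b | label-2^i*3 {b} {0} z≤n = refl
levels-not-label b (suc j) j<b rewrite label-2^[1+i] j<b | label-2^i*3 j<b = begin
  0 + 2 ^ suc j * 3 + S + 2   ≡⟨ +-assoc (2 ^ suc j * 3) S 2 ⟩
  2 ^ suc j * 3 + (S + 2)     ≡⟨ cong (2 ^ suc j * 3 +_) (levels-not-label b j (<⇒≤ j<b)) ⟩
  2 ^ suc j * 3 + 3 * 2 ^ suc j ≡⟨ double (2 ^ suc j) ⟩
  3 * (2 * 2 ^ suc j) ∎
  where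
  open ≡-Reasoning
  S = sum (map (level (not ∘ label b)) (downFrom (suc j)))
  double : ∀ p → p * 3 + 3 * p ≡ 3 * (2 * p)
  double = solve-∀

sumWhere-divisors-2^k*3 : ∀ k g → sumWhere g (divisors (2 ^ k * 3)) ≡ sum (map (level g) (downFrom (suc k)))
sumWhere-divisors-2^k*3 k g = begin
  sumWhere g (divisors (2 ^ k * 3))
    ≡⟨ sum-divisors-*-coprime {{m^n≢0 2 k}} (2^k⊥3 k) (select g) ⟩
  sum (map (λ x → sum (map (λ y → select g (x * y)) (divisors 3))) (divisors (2 ^ k)))
    ≡⟨ sum-divisors-^ prime[2] k _ ⟩
  sum (map (λ i → select g (2 ^ i * 1) + (select g (2 ^ i * 3) + 0)) (downFrom (suc k)))
    ≡⟨ sum-map-cong (downFrom (suc k)) (λ {i} _ →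
         cong₂ _+_ (cong (select g) (*-identityʳ (2 ^ i))) (+-identityʳ _)) ⟩
  sum (map (level g) (downFrom (suc k))) ∎
  where open ≡-Reasoning

sumWhere-label : ∀ b → sumWhere (label b) (divisors (2 ^ suc b * 3)) + 2 ≡ 2 ^ suc b * 3 + 2 ^ suc b
sumWhere-label b
  rewrite sumWhere-divisors-2^k*3 (suc b) (label b) | label-2^[1+b] b | label-2^[1+b]*3 b = begin
  2 ^ suc b * 3 + S + 2   ≡⟨ +-assoc (2 ^ suc b * 3) S 2 ⟩
  2 ^ suc b * 3 + (S + 2) ≡⟨ cong (2 ^ suc b * 3 +_) (levels-label b b ≤-refl) ⟩
  2 ^ suc b * 3 + 2 ^ suc b ∎
  where
  open ≡-Reasoning
  S = sum (map (level (label b)) (downFrom (suc b)))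

sumWhere-not-label : ∀ b → sumWhere (not ∘ label b) (divisors (2 ^ suc b * 3)) + 2 ≡ 2 ^ suc b * 3 + 2 ^ suc b
sumWhere-not-label b
  rewrite sumWhere-divisors-2^k*3 (suc b) (not ∘ label b) | label-2^[1+b] b | label-2^[1+b]*3 b = begin
  2 ^ suc b + 0 + S + 2       ≡⟨ +-assoc (2 ^ suc b + 0) S 2 ⟩
  2 ^ suc b + 0 + (S + 2)     ≡⟨ cong (2 ^ suc b + 0 +_) (levels-not-label b b ≤-refl) ⟩
  2 ^ suc b + 0 + 3 * 2 ^ suc b ≡⟨ rearrange (2 ^ suc b) ⟩
  2 ^ suc b * 3 + 2 ^ suc b   ∎
  where
  open ≡-Reasoning
  S = sum (map (level (not ∘ label b)) (downFrom (suc b)))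
  rearrange : ∀ p → p + 0 + 3 * p ≡ p * 3 + p
  rearrange = solve-∀

evenSplit-label : ∀ b → EvenSplit (label b) (2 ^ suc b * 3)
evenSplit-label b = +-cancelʳ-≡ 2 _ _ (trans (sumWhere-label b) (sym (sumWhere-not-label b)))

zumkeller-2^[1+b]*3*r : ∀ b r .{{_ : NonZero r}} → ¬ 2 ∣ r → ¬ 3 ∣ r → Zumkeller (2 ^ suc b * 3 * r)
zumkeller-2^[1+b]*3*r b r 2∤r 3∤r =
  evenSplit⇒zumkeller {{m*n≢0 a r}} _ (evenSplit-*-coprime a⊥r (label b) (evenSplit-label b))
  where
  a = 2 ^ suc b * 3
  instance _ = m*n≢0 (2 ^ suc b) 3 {{m^n≢0 2 (suc b)}}
  a⊥r : Coprime a r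
  a⊥r = coprime-*ˡ (coprime-^ˡ (suc b) (prime∤⇒coprime prime[2] 2∤r)) (prime∤⇒coprime prime[3] 3∤r)

-- Sums of a Zumkeller number and a prime

factor-out-power : ∀ p .{{_ : NonTrivial p}} m .{{_ : NonZero m}} → ∃[ b ] ∃[ r ] (¬ p ∣ r × m ≡ p ^ b * r)
factor-out-power p m {{m≢0}} = <-rec P step m m≢0
  where
  P : ℕ → Set
  P m = .(NonZero m) → ∃[ b ] ∃[ r ] (¬ p ∣ r × m ≡ p ^ b * r)
  step : ∀ m → (∀ {k} → k < m → P k) → P m
  step m rec m≢0 with p ∣? m
  ... | no p∤m = 0 , m , p∤m , sym (*-identityˡ m)
  ... | yes p∣m with b , r , p∤r , q≡ ← rec (quotient-< p∣m {{it}} {{m≢0}}) (quotient≢0 p∣m {{m≢0}}) =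
    suc b , r , p∤r , (begin
      m                   ≡⟨ m∣n⇒n≡m*quotient p∣m ⟩
      p * quotient p∣m    ≡⟨ cong (p *_) q≡ ⟩
      p * (p ^ b * r)     ≡⟨ *-assoc p (p ^ b) r ⟨
      p ^ suc b * r       ∎)
    where open ≡-Reasoning

zumkeller-6* : ∀ m .{{_ : NonZero m}} → ¬ 3 ∣ m → Zumkeller (6 * m)
zumkeller-6* m {{m≢0}} 3∤m with b , r , 2∤r , refl ← factor-out-power 2 m =
  subst Zumkeller (regroup (2 ^ b) r)
    (zumkeller-2^[1+b]*3*r b r {{m*n≢0⇒n≢0 (2 ^ b) {{m≢0}}}} 2∤r (3∤m ∘ ∣n⇒∣m*n (2 ^ b)))
  where
  regroup : ∀ x y → 2 * x * 3 * y ≡ 6 * (x * y)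
  regroup = solve-∀

ZumkellerPlusPrime : ℕ → Set
ZumkellerPlusPrime n = ∃[ z ] ∃[ p ] (Zumkeller z × Prime p × n ≡ z + p)

zumkeller+prime : ∀ q s .{{_ : NonZero s}} → ¬ 3 ∣ s → ∀ {p} → Prime p →
  ZumkellerPlusPrime (6 * s + p + q * 18)
zumkeller+prime q s 3∤s {p} prime-p =
  6 * t , p , zumkeller-6* t {{t≢0}} 3∤t , prime-p , regroup q s p
  where
  t = 3 * q + s
  t≢0 = >-nonZero (<-≤-trans (>-nonZero⁻¹ s) (m≤n+m s (3 * q)))
  3∤t : ¬ 3 ∣ t
  3∤t 3∣t = 3∤s (∣m+n∣m⇒∣n 3∣t (m∣m*n q))
  regroup : ∀ q s p → 6 * s + p + q * 18 ≡ 6 * (3 * q + s) + p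
  regroup = solve-∀

from-second-period : ∀ {r} → ¬ 8 ≤ r → (∀ q → ZumkellerPlusPrime (r + suc q * 18)) →
  ∀ q → 8 ≤ r + q * 18 → ZumkellerPlusPrime (r + q * 18)
from-second-period {r = r} 8≰r next zero 8≤r = contradiction (subst (8 ≤_) (+-identityʳ r) 8≤r) 8≰r
from-second-period 8≰r next (suc q) _ = next q

-- The residue r is hit as 6 s + p with s ∈ {1, 2}; for r < 8 this happens only from r + 18 on.
residues-representable : All (λ r → ∀ q → 8 ≤ r + q * 18 → ZumkellerPlusPrime (r + q * 18))
                             (1 ∷ 5 ∷ 7 ∷ 8 ∷ 9 ∷ 11 ∷ 13 ∷ 14 ∷ 15 ∷ 17 ∷ [])
residues-representable =
    from-second-period (from-no (8 ≤? 1)) (λ q → zumkeller+prime q 2 3∤2 (from-yes (prime? 7)))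
  ∷ from-second-period (from-no (8 ≤? 5)) (λ q → zumkeller+prime q 2 3∤2 (from-yes (prime? 11)))
  ∷ from-second-period (from-no (8 ≤? 7)) (λ q → zumkeller+prime q 2 3∤2 (from-yes (prime? 13)))
  ∷ (λ q _ → zumkeller+prime q 1 3∤1 prime[2])
  ∷ (λ q _ → zumkeller+prime q 1 3∤1 prime[3])
  ∷ (λ q _ → zumkeller+prime q 1 3∤1 (from-yes (prime? 5)))
  ∷ (λ q _ → zumkeller+prime q 1 3∤1 (from-yes (prime? 7)))
  ∷ (λ q _ → zumkeller+prime q 2 3∤2 prime[2])
  ∷ (λ q _ → zumkeller+prime q 2 3∤2 prime[3])
  ∷ (λ q _ → zumkeller+prime q 2 3∤2 (from-yes (prime? 5)))
  ∷ []
  where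
  3∤1 = from-no (3 ∣? 1)
  3∤2 = from-no (3 ∣? 2)

proposition4p12 : (n : ℕ) → n % 18 ∈ (1 ∷ 5 ∷ 7 ∷ 8 ∷ 9 ∷ 11 ∷ 13 ∷ 14 ∷ 15 ∷ 17 ∷ [])
    → ((∃[ z ] ∃[ p ] (Zumkeller z × Prime p × n ≡ z + p)) ⇔ n ≥ 8)
proposition4p12 n n%18∈ = mk⇔ ≥8 representable
  where
  n≡ = m≡m%n+[m/n]*n n 18
  ≥8 : ZumkellerPlusPrime n → n ≥ 8
  ≥8 (z , p , zumkeller-z , prime-p , refl) =
    +-mono-≤ (zumkeller⇒6≤ zumkeller-z) (nonTrivial⇒n>1 p {{prime⇒nonTrivial prime-p}})
  representable : n ≥ 8 → ZumkellerPlusPrime n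
  representable 8≤n = subst ZumkellerPlusPrime (sym n≡)
    (All.lookup residues-representable n%18∈ (n / 18) (subst (8 ≤_) n≡ 8≤n))
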